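{- Let $p$ be a prime, $d\mid p-1$ with $1<d<p-1$. If $A\subseteq\mathbb F_p$ and $(A,-A)$ is $d$-critical, then for every $a\in A$ the set \[A^a=\{0\}\cup\Big\{\frac{1}{a-a'}: a'\in A,\ a'\ne a\Big\}\] also makes $(A^a,-A^a)$ a $d$-critical pair.
   Context: $\mu_d$ is the set of $d$-th roots of unity in $\mathbb F_p$. A pair $(A,B)$ of subsets of $\mathbb F_p$ with $|A|,|B|>1$ is $d$-critical if $A+B\subseteq\mu_d\cup\{0\}$ and $|A||B|=d+|(-A)\cap B|$. -}

module Defs where

open import Data.Nat using (ℕ; zero; suc; _+_; _*_; _∸_; _<_; NonZero)
open import Data.Nat.DivMod using (_mod_)
open import Data.Fin using (Fin; toℕ)
open import Data.Fin.Subset using (Subset; _∈_; _∩_; ∣_∣)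
open import Data.Vec using (tabulate; lookup)
open import Data.Product using (_×_)
open import Data.Sum using (_⊎_)
open import Relation.Binary.PropositionalEquality using (_≡_)

module _ (p : ℕ) .{{_ : NonZero p}} where

  0ₚ : Fin p
  0ₚ = 0 mod p

  1ₚ : Fin p
  1ₚ = 1 mod p

  addₚ : Fin p → Fin p → Fin p
  addₚ x y = (toℕ x + toℕ y) mod p

  mulₚ : Fin p → Fin p → Fin p
  mulₚ x y = (toℕ x * toℕ y) mod p

  negₚ : Fin p → Fin p
  negₚ x = (p ∸ toℕ x) mod p

  subₚ : Fin p → Fin p → Fin p
  subₚ x y = addₚ x (negₚ y)

  powₚ : Fin p → ℕ → Fin p
  powₚ x zero    = 1ₚ
  powₚ x (suc k) = mulₚ x (powₚ x k)

  μ : ℕ → Fin p → Set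
  μ d x = powₚ x d ≡ 1ₚ

  negSet : Subset p → Subset p
  negSet A = tabulate (λ x → lookup A (negₚ x))

  Critical : ℕ → Subset p → Subset p → Set
  Critical d A B =
    (1 < ∣ A ∣) × (1 < ∣ B ∣)
    × (∀ a b → a ∈ A → b ∈ B → (addₚ a b ≡ 0ₚ ⊎ μ d (addₚ a b)))
    × (∣ A ∣ * ∣ B ∣ ≡ d + ∣ negSet A ∩ B ∣)

-- (A, -A) is d-critical iff |A| > 1, A - A ⊆ μ_d ∪ {0} and |A|² = d + |A|, since -A ∩ -A = -A and |-A| = |A|.
-- For u = 1/(a - a′) and y = 1/(a - a″) in A^a one has u - y = (a′ - a″)/((a - a′)(a - a″)): an element of μ_d ∪ {0}
-- divided by elements of μ_d, so A^a - A^a ⊆ μ_d ∪ {0}. Moreover y ↦ a - 1/y maps A^a bijectively onto A, so |A^a| = |A|.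
module Submission where

open import Defs
open import Data.Nat using (ℕ; _<_; _∸_; NonZero; zero; suc; >-nonZero⁻¹)
open import Data.Nat.Divisibility using (_∣_)
open import Data.Nat.Primality using (Prime)
import Data.Nat.Properties as ℕ
open import Data.Nat.DivMod using (_mod_; _%_; %-distribˡ-+; %-distribˡ-*; m<n⇒m%n≡m; n%n≡0)
open import Data.Fin using (Fin; toℕ)
open import Data.Fin.Properties using (toℕ-injective; toℕ-fromℕ<; fromℕ<-cong; toℕ<n; _≟_)
open import Data.Fin.Subset using (Subset; _∈_; _∩_; ∣_∣)
open import Data.Fin.Subset.Properties using (∩-idem)
open import Data.Fin.Permutation using (Permutation′; permutation; _⟨$⟩ʳ_)
open import Data.Bool using (Bool; true; false)
open import Data.Vec using ([]; _∷_; lookup)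
open import Data.Vec.Properties using ([]=⇒lookup; lookup⇒[]=; lookup∘tabulate)
open import Data.Product using (_×_; ∃-syntax; _,_)
open import Data.Sum using (_⊎_; inj₁; inj₂; [_,_]′; map₂)
open import Relation.Nullary using (¬_; Dec; yes; no; contradiction)
open import Relation.Unary using (Pred)
open import Function using (_∘_; Equivalence; mk⇔)
open import Function.Bundles using (_⇔_)
open import Level using (0ℓ; _⊔_)
open import Algebra.Bundles using (CommutativeRing)
open import Algebra.Structures using (IsCommutativeRing)
open import Algebra.Consequences.Propositional using (comm∧idˡ⇒id; comm∧invˡ⇒inv; comm∧distrˡ⇒distrʳ)
open import Relation.Binary.PropositionalEquality using (_≡_)
import Relation.Binary.PropositionalEquality as ≡

module RootsOfUnity {c ℓ} (R : CommutativeRing c ℓ) (d : ℕ) where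

  open CommutativeRing R
  open import Algebra.Properties.Ring ring using (-‿distribˡ-*; -‿distribʳ-*; [y-z]x≈yx-zx)
  open import Algebra.Properties.AbelianGroup +-abelianGroup using (⁻¹-anti-homo‿-; xyx⁻¹≈y; ε⁻¹≈ε)
  open import Algebra.Properties.Semiring.Exp semiring using (_^_; ^-congˡ)
  open import Algebra.Properties.CommutativeSemiring.Exp commutativeSemiring using (^-distrib-*)
  open import Relation.Binary.Reasoning.Setoid setoid

  RootOfUnity : Carrier → Set ℓ
  RootOfUnity x = x ^ d ≈ 1#

  RootOfUnity₀ : Carrier → Set ℓ
  RootOfUnity₀ x = x ≈ 0# ⊎ RootOfUnity x

  DifferencesIn : ∀ {ℓ′} → Pred Carrier ℓ′ → Set (c ⊔ ℓ ⊔ ℓ′)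
  DifferencesIn A = ∀ {x y} → A x → A y → RootOfUnity₀ (x - y)

  Reciprocals : ∀ {ℓ′} → Pred Carrier ℓ′ → Carrier → Pred Carrier (c ⊔ ℓ ⊔ ℓ′)
  Reciprocals A a x = x ≈ 0# ⊎ ∃[ a′ ] (A a′ × a′ ≉ a × x * (a - a′) ≈ 1#)

  x-0≈x : ∀ x → x - 0# ≈ x
  x-0≈x x = trans (+-congˡ ε⁻¹≈ε) (+-identityʳ x)

  x-[x-y]≈y : ∀ x y → x - (x - y) ≈ y
  x-[x-y]≈y x y = begin
    x - (x - y)   ≈⟨ +-congˡ (⁻¹-anti-homo‿- x y) ⟩
    x + (y - x)   ≈⟨ +-assoc x y (- x) ⟨
    x + y - x     ≈⟨ xyx⁻¹≈y x y ⟩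
    y             ∎

  [x-z]-[x-y]≈y-z : ∀ x y z → (x - z) - (x - y) ≈ y - z
  [x-z]-[x-y]≈y-z x y z = begin
    (x - z) - (x - y)    ≈⟨ +-congˡ (⁻¹-anti-homo‿- x y) ⟩
    (x - z) + (y - x)    ≈⟨ +-assoc (x - z) y (- x) ⟨
    (x - z) + y - x      ≈⟨ +-congʳ (+-assoc x (- z) y) ⟩
    x + (- z + y) - x    ≈⟨ +-congʳ (+-congˡ (+-comm (- z) y)) ⟩
    x + (y - z) - x      ≈⟨ xyx⁻¹≈y x (y - z) ⟩
    y - z                ∎

  x*y≈1⇒x*[y*z]≈z : ∀ {x y} z → x * y ≈ 1# → x * (y * z) ≈ z
  x*y≈1⇒x*[y*z]≈z {x} {y} z xy≈1 = begin
    x * (y * z)   ≈⟨ *-assoc x y z ⟨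
    x * y * z     ≈⟨ *-congʳ xy≈1 ⟩
    1# * z        ≈⟨ *-identityˡ z ⟩
    z             ∎

  inverse-unique : ∀ {x y z} → x * y ≈ 1# → x * z ≈ 1# → y ≈ z
  inverse-unique {x} {y} {z} xy≈1 xz≈1 = begin
    y             ≈⟨ x*y≈1⇒x*[y*z]≈z y (trans (*-comm z x) xz≈1) ⟨
    z * (x * y)   ≈⟨ *-congˡ xy≈1 ⟩
    z * 1#        ≈⟨ *-identityʳ z ⟩
    z             ∎

  1#^n≈1# : ∀ n → 1# ^ n ≈ 1#
  1#^n≈1# zero    = refl
  1#^n≈1# (suc n) = trans (*-identityˡ _) (1#^n≈1# n)

  ^-absorbs-root : ∀ {y} x → RootOfUnity y → x ^ d ≈ (x * y) ^ d
  ^-absorbs-root {y} x y^d≈1 = begin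
    x ^ d           ≈⟨ *-identityʳ _ ⟨
    x ^ d * 1#      ≈⟨ *-congˡ y^d≈1 ⟨
    x ^ d * y ^ d   ≈⟨ ^-distrib-* x y d ⟨
    (x * y) ^ d     ∎

  rootOfUnity-* : ∀ {x y} → RootOfUnity x → RootOfUnity y → RootOfUnity (x * y)
  rootOfUnity-* {x} {y} x^d≈1 y^d≈1 = begin
    (x * y) ^ d   ≈⟨ ^-absorbs-root x y^d≈1 ⟨
    x ^ d         ≈⟨ x^d≈1 ⟩
    1#            ∎

  inverse-rootOfUnity : ∀ {x y} → x * y ≈ 1# → RootOfUnity y → RootOfUnity x
  inverse-rootOfUnity {x} {y} xy≈1 y^d≈1 = begin
    x ^ d         ≈⟨ ^-absorbs-root x y^d≈1 ⟩
    (x * y) ^ d   ≈⟨ ^-congˡ d xy≈1 ⟩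
    1# ^ d        ≈⟨ 1#^n≈1# d ⟩
    1#            ∎

  -- If y ≈ 0# is invertible the ring is trivial, and then y is a root of unity as well.
  unit-rootOfUnity₀⇒rootOfUnity : ∀ {x y} → x * y ≈ 1# → RootOfUnity₀ y → RootOfUnity y
  unit-rootOfUnity₀⇒rootOfUnity         xy≈1 (inj₂ y^d≈1) = y^d≈1
  unit-rootOfUnity₀⇒rootOfUnity {x} {y} xy≈1 (inj₁ y≈0) = begin
    y ^ d         ≈⟨ *-identityʳ _ ⟨
    y ^ d * 1#    ≈⟨ *-congˡ 1≈0 ⟩
    y ^ d * 0#    ≈⟨ zeroʳ _ ⟩
    0#            ≈⟨ 1≈0 ⟨
    1#            ∎
    where
    1≈0 : 1# ≈ 0#
    1≈0 = trans (sym xy≈1) (trans (*-congˡ y≈0) (zeroʳ x))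

  -- For n = 0 every element satisfies x ^ n ≈ 1#, so x ≈ 0# cannot be concluded.
  x*y≈0∧y^n≈1⇒x≈0⊎x^n≈1 : ∀ n {x y} → x * y ≈ 0# → y ^ n ≈ 1# → x ≈ 0# ⊎ x ^ n ≈ 1#
  x*y≈0∧y^n≈1⇒x≈0⊎x^n≈1 zero    xy≈0 y^n≈1 = inj₂ refl
  x*y≈0∧y^n≈1⇒x≈0⊎x^n≈1 (suc k) {x} {y} xy≈0 y^n≈1 = inj₁ (begin
    x                 ≈⟨ *-identityʳ x ⟨
    x * 1#            ≈⟨ *-congˡ y^n≈1 ⟨
    x * (y * y ^ k)   ≈⟨ *-assoc x y _ ⟨
    x * y * y ^ k     ≈⟨ *-congʳ xy≈0 ⟩
    0# * y ^ k        ≈⟨ zeroˡ _ ⟩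
    0#                ∎)

  rootOfUnity₀-cancel : ∀ {x y z} → x * y ≈ z → RootOfUnity y →
                        RootOfUnity₀ z → RootOfUnity₀ x
  rootOfUnity₀-cancel {x} {y} {z} xy≈z y^d≈1 (inj₂ z^d≈1) = inj₂ (begin
    x ^ d         ≈⟨ ^-absorbs-root x y^d≈1 ⟩
    (x * y) ^ d   ≈⟨ ^-congˡ d xy≈z ⟩
    z ^ d         ≈⟨ z^d≈1 ⟩
    1#            ∎)
  rootOfUnity₀-cancel xy≈z y^d≈1 (inj₁ z≈0) = x*y≈0∧y^n≈1⇒x≈0⊎x^n≈1 d (trans xy≈z z≈0) y^d≈1

  module _ {ℓ′} {A : Pred Carrier ℓ′} (differences : DifferencesIn A)
           {a : Carrier} (a∈A : A a) where

    private
      invertible-difference : ∀ {x b c} → A b → A c → x * (b - c) ≈ 1# → RootOfUnity (b - c)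
      invertible-difference b∈A c∈A x[b-c]≈1 =
        unit-rootOfUnity₀⇒rootOfUnity x[b-c]≈1 (differences b∈A c∈A)

    reciprocals-differences : DifferencesIn (Reciprocals A a)
    reciprocals-differences {u} {y} (inj₁ u≈0) (inj₁ y≈0) = inj₁ (begin
      u - y     ≈⟨ +-cong u≈0 (-‿cong y≈0) ⟩
      0# - 0#   ≈⟨ -‿inverseʳ 0# ⟩
      0#        ∎)
    reciprocals-differences {u} {y} (inj₁ u≈0) (inj₂ (a″ , a″∈A , _ , y[a-a″]≈1)) =
      inj₂ (inverse-rootOfUnity [u-y][a″-a]≈1 (invertible-difference a″∈A a∈A [u-y][a″-a]≈1))
      where
      [u-y][a″-a]≈1 : (u - y) * (a″ - a) ≈ 1#
      [u-y][a″-a]≈1 = begin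
        (u - y) * (a″ - a)     ≈⟨ *-congʳ (trans (+-congʳ u≈0) (+-identityˡ (- y))) ⟩
        - y * (a″ - a)         ≈⟨ -‿distribˡ-* y _ ⟨
        - (y * (a″ - a))       ≈⟨ -‿distribʳ-* y _ ⟩
        y * - (a″ - a)         ≈⟨ *-congˡ (⁻¹-anti-homo‿- a″ a) ⟩
        y * (a - a″)           ≈⟨ y[a-a″]≈1 ⟩
        1#                     ∎
    reciprocals-differences {u} {y} (inj₂ (a′ , a′∈A , _ , u[a-a′]≈1)) (inj₁ y≈0) =
      inj₂ (inverse-rootOfUnity [u-y][a-a′]≈1 (invertible-difference a∈A a′∈A [u-y][a-a′]≈1))
      where
      [u-y][a-a′]≈1 : (u - y) * (a - a′) ≈ 1#
      [u-y][a-a′]≈1 = trans (*-congʳ (trans (+-congˡ (-‿cong y≈0)) (x-0≈x u))) u[a-a′]≈1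
    reciprocals-differences {u} {y} (inj₂ (a′ , a′∈A , _ , u[a-a′]≈1))
                                    (inj₂ (a″ , a″∈A , _ , y[a-a″]≈1)) =
      rootOfUnity₀-cancel [u-y][a-a′][a-a″]≈a′-a″
        (rootOfUnity-* (invertible-difference a∈A a′∈A u[a-a′]≈1)
                       (invertible-difference a∈A a″∈A y[a-a″]≈1))
        (differences a′∈A a″∈A)
      where
      [u-y][a-a′][a-a″]≈a′-a″ : (u - y) * ((a - a′) * (a - a″)) ≈ a′ - a″
      [u-y][a-a′][a-a″]≈a′-a″ = begin
        (u - y) * ((a - a′) * (a - a″))
          ≈⟨ [y-z]x≈yx-zx _ u y ⟩
        u * ((a - a′) * (a - a″)) - y * ((a - a′) * (a - a″))
          ≈⟨ +-cong (x*y≈1⇒x*[y*z]≈z _ u[a-a′]≈1)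
                    (-‿cong (trans (*-congˡ (*-comm _ _)) (x*y≈1⇒x*[y*z]≈z _ y[a-a″]≈1))) ⟩
        (a - a″) - (a - a′)
          ≈⟨ [x-z]-[x-y]≈y-z a a′ a″ ⟩
        a′ - a″ ∎

open ≡ using (refl; sym; trans; cong; cong₂; subst; subst₂; _≢_; module ≡-Reasoning)

module ResidueRing (p : ℕ) .{{_ : NonZero p}} where

  open import Data.Nat using (_+_; _*_)
  open ≡-Reasoning

  [_] : ℕ → Fin p
  [ n ] = n mod p

  toℕ-[] : ∀ n → toℕ [ n ] ≡ n % p
  toℕ-[] n = toℕ-fromℕ< _

  []-toℕ : ∀ x → [ toℕ x ] ≡ x
  []-toℕ x = toℕ-injective (trans (toℕ-[] (toℕ x)) (m<n⇒m%n≡m (toℕ<n x)))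

  []-cong-% : ∀ {m n} → m % p ≡ n % p → [ m ] ≡ [ n ]
  []-cong-% m%p≡n%p = fromℕ<-cong _ _ m%p≡n%p _ _

  +-homo : ∀ m n → addₚ p [ m ] [ n ] ≡ [ m + n ]
  +-homo m n = []-cong-% (begin
    (toℕ [ m ] + toℕ [ n ]) % p   ≡⟨ cong₂ (λ u v → (u + v) % p) (toℕ-[] m) (toℕ-[] n) ⟩
    (m % p + n % p) % p           ≡⟨ %-distribˡ-+ m n p ⟨
    (m + n) % p                   ∎)

  *-homo : ∀ m n → mulₚ p [ m ] [ n ] ≡ [ m * n ]
  *-homo m n = []-cong-% (begin
    (toℕ [ m ] * toℕ [ n ]) % p   ≡⟨ cong₂ (λ u v → (u * v) % p) (toℕ-[] m) (toℕ-[] n) ⟩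
    (m % p * (n % p)) % p         ≡⟨ %-distribˡ-* m n p ⟨
    (m * n) % p                   ∎)

  -- Every law of ℤ/pℤ is inherited from ℕ along the surjection [_].
  on-residues₂ : {f g : Fin p → Fin p → Fin p} →
                 (∀ m n → f [ m ] [ n ] ≡ g [ m ] [ n ]) → ∀ x y → f x y ≡ g x y
  on-residues₂ {f} {g} eq x y =
    subst₂ (λ u v → f u v ≡ g u v) ([]-toℕ x) ([]-toℕ y) (eq (toℕ x) (toℕ y))

  on-residues₃ : {f g : Fin p → Fin p → Fin p → Fin p} →
                 (∀ m n o → f [ m ] [ n ] [ o ] ≡ g [ m ] [ n ] [ o ]) → ∀ x y z → f x y z ≡ g x y z
  on-residues₃ {f} {g} eq x y z = subst (λ w → f x y w ≡ g x y w) ([]-toℕ z)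
    (on-residues₂ {λ u v → f u v [ toℕ z ]} {λ u v → g u v [ toℕ z ]} (λ m n → eq m n (toℕ z)) x y)

  private
    _+ₚ_ _*ₚ_ : Fin p → Fin p → Fin p
    _+ₚ_ = addₚ p
    _*ₚ_ = mulₚ p
    infixl 6 _+ₚ_
    infixl 7 _*ₚ_

  +ₚ-comm : ∀ x y → x +ₚ y ≡ y +ₚ x
  +ₚ-comm = on-residues₂ λ m n → cong [_] (ℕ.+-comm (toℕ [ m ]) (toℕ [ n ]))

  *ₚ-comm : ∀ x y → x *ₚ y ≡ y *ₚ x
  *ₚ-comm = on-residues₂ λ m n → cong [_] (ℕ.*-comm (toℕ [ m ]) (toℕ [ n ]))

  +ₚ-assoc : ∀ x y z → (x +ₚ y) +ₚ z ≡ x +ₚ (y +ₚ z)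
  +ₚ-assoc = on-residues₃ λ m n o → begin
    [ m ] +ₚ [ n ] +ₚ [ o ]     ≡⟨ trans (cong (_+ₚ [ o ]) (+-homo m n)) (+-homo (m + n) o) ⟩
    [ m + n + o ]               ≡⟨ cong [_] (ℕ.+-assoc m n o) ⟩
    [ m + (n + o) ]             ≡⟨ trans (cong ([ m ] +ₚ_) (+-homo n o)) (+-homo m (n + o)) ⟨
    [ m ] +ₚ ([ n ] +ₚ [ o ])   ∎

  *ₚ-assoc : ∀ x y z → (x *ₚ y) *ₚ z ≡ x *ₚ (y *ₚ z)
  *ₚ-assoc = on-residues₃ λ m n o → begin
    [ m ] *ₚ [ n ] *ₚ [ o ]     ≡⟨ trans (cong (_*ₚ [ o ]) (*-homo m n)) (*-homo (m * n) o) ⟩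
    [ m * n * o ]               ≡⟨ cong [_] (ℕ.*-assoc m n o) ⟩
    [ m * (n * o) ]             ≡⟨ trans (cong ([ m ] *ₚ_) (*-homo n o)) (*-homo m (n * o)) ⟨
    [ m ] *ₚ ([ n ] *ₚ [ o ])   ∎

  *ₚ-distribˡ-+ₚ : ∀ x y z → x *ₚ (y +ₚ z) ≡ x *ₚ y +ₚ x *ₚ z
  *ₚ-distribˡ-+ₚ = on-residues₃ λ m n o → begin
    [ m ] *ₚ ([ n ] +ₚ [ o ])         ≡⟨ trans (cong ([ m ] *ₚ_) (+-homo n o)) (*-homo m (n + o)) ⟩
    [ m * (n + o) ]                   ≡⟨ cong [_] (ℕ.*-distribˡ-+ m n o) ⟩
    [ m * n + m * o ]                 ≡⟨ trans (cong₂ _+ₚ_ (*-homo m n) (*-homo m o)) (+-homo (m * n) (m * o)) ⟨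
    [ m ] *ₚ [ n ] +ₚ [ m ] *ₚ [ o ]  ∎

  +ₚ-identityˡ : ∀ x → 0ₚ p +ₚ x ≡ x
  +ₚ-identityˡ x = trans (cong (0ₚ p +ₚ_) (sym ([]-toℕ x))) (trans (+-homo 0 (toℕ x)) ([]-toℕ x))

  *ₚ-identityˡ : ∀ x → 1ₚ p *ₚ x ≡ x
  *ₚ-identityˡ x = begin
    1ₚ p *ₚ x              ≡⟨ cong (1ₚ p *ₚ_) ([]-toℕ x) ⟨
    1ₚ p *ₚ [ toℕ x ]      ≡⟨ *-homo 1 (toℕ x) ⟩
    [ 1 * toℕ x ]          ≡⟨ cong [_] (ℕ.*-identityˡ (toℕ x)) ⟩
    [ toℕ x ]              ≡⟨ []-toℕ x ⟩
    x                      ∎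

  -ₚ‿inverseˡ : ∀ x → negₚ p x +ₚ x ≡ 0ₚ p
  -ₚ‿inverseˡ x = begin
    negₚ p x +ₚ x               ≡⟨ cong (negₚ p x +ₚ_) ([]-toℕ x) ⟨
    negₚ p x +ₚ [ toℕ x ]       ≡⟨ +-homo (p ∸ toℕ x) (toℕ x) ⟩
    [ p ∸ toℕ x + toℕ x ]       ≡⟨ cong [_] (ℕ.m∸n+n≡m (ℕ.<⇒≤ (toℕ<n x))) ⟩
    [ p ]                       ≡⟨ []-cong-% (trans (n%n≡0 p) (sym (m<n⇒m%n≡m (>-nonZero⁻¹ p)))) ⟩
    [ 0 ]                       ∎

  isCommutativeRing : IsCommutativeRing _≡_ (addₚ p) (mulₚ p) (negₚ p) (0ₚ p) (1ₚ p)
  isCommutativeRing = record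
    { isRing = record
      { +-isAbelianGroup = record
        { isGroup = record
          { isMonoid = record
            { isSemigroup = record
              { isMagma = record { isEquivalence = ≡.isEquivalence ; ∙-cong = cong₂ _+ₚ_ }
              ; assoc = +ₚ-assoc }
            ; identity = comm∧idˡ⇒id +ₚ-comm +ₚ-identityˡ }
          ; inverse = comm∧invˡ⇒inv +ₚ-comm -ₚ‿inverseˡ
          ; ⁻¹-cong = cong (negₚ p) }
        ; comm = +ₚ-comm }
      ; *-cong = cong₂ _*ₚ_
      ; *-assoc = *ₚ-assoc
      ; *-identity = comm∧idˡ⇒id *ₚ-comm *ₚ-identityˡ
      ; distrib = *ₚ-distribˡ-+ₚ , comm∧distrˡ⇒distrʳ *ₚ-comm *ₚ-distribˡ-+ₚ }
    ; *-comm = *ₚ-comm }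

  commutativeRing : CommutativeRing 0ℓ 0ℓ
  commutativeRing = record { isCommutativeRing = isCommutativeRing }

  open import Algebra.Properties.Semiring.Exp (CommutativeRing.semiring commutativeRing) using (_^_)

  powₚ≡^ : ∀ x n → powₚ p x n ≡ x ^ n
  powₚ≡^ x zero    = refl
  powₚ≡^ x (suc n) = cong (x *ₚ_) (powₚ≡^ x n)

  0ₚ≢1ₚ : 1 < p → 0ₚ p ≢ 1ₚ p
  0ₚ≢1ₚ 1<p 0≡1 with () ← begin
    0             ≡⟨ m<n⇒m%n≡m (>-nonZero⁻¹ p) ⟨
    0 % p         ≡⟨ toℕ-[] 0 ⟨
    toℕ (0ₚ p)    ≡⟨ cong toℕ 0≡1 ⟩
    toℕ (1ₚ p)    ≡⟨ toℕ-[] 1 ⟩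
    1 % p         ≡⟨ m<n⇒m%n≡m 1<p ⟩
    1             ∎

module _ {n : ℕ} where

  private
    indicator : Bool → ℕ
    indicator true  = 1
    indicator false = 0

  open import Algebra.Properties.CommutativeMonoid.Sum ℕ.+-0-commutativeMonoid
    using (sum; sum-permute; sum-cong-≗)

  ∣∣≡sum-indicator : ∀ {m} (X : Subset m) → ∣ X ∣ ≡ sum (indicator ∘ lookup X)
  ∣∣≡sum-indicator []          = refl
  ∣∣≡sum-indicator (true ∷ X)  = cong suc (∣∣≡sum-indicator X)
  ∣∣≡sum-indicator (false ∷ X) = ∣∣≡sum-indicator X

  ∈⇔⇒lookup≡ : ∀ {X Y : Subset n} {i j} → (i ∈ X ⇔ j ∈ Y) → lookup X i ≡ lookup Y j
  ∈⇔⇒lookup≡ {X} {Y} {i} {j} i∈X⇔j∈Y with lookup X i in Xi | lookup Y j in Yj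
  ... | true  | true  = refl
  ... | false | false = refl
  ... | true  | false = sym (trans (sym Yj) ([]=⇒lookup (Equivalence.to   i∈X⇔j∈Y (lookup⇒[]= i X Xi))))
  ... | false | true  = trans (sym Xi)      ([]=⇒lookup (Equivalence.from i∈X⇔j∈Y (lookup⇒[]= j Y Yj)))

  ∣∣-permute : ∀ (π : Permutation′ n) {X Y : Subset n} →
               (∀ i → i ∈ Y ⇔ (π ⟨$⟩ʳ i) ∈ X) → ∣ Y ∣ ≡ ∣ X ∣
  ∣∣-permute π {X} {Y} Y⇔πX = begin
    ∣ Y ∣                                  ≡⟨ ∣∣≡sum-indicator Y ⟩
    sum (indicator ∘ lookup Y)             ≡⟨ sum-cong-≗ (cong indicator ∘ ∈⇔⇒lookup≡ ∘ Y⇔πX) ⟩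
    sum (indicator ∘ lookup X ∘ (π ⟨$⟩ʳ_)) ≡⟨ sum-permute (indicator ∘ lookup X) π ⟨
    sum (indicator ∘ lookup X)             ≡⟨ ∣∣≡sum-indicator X ⟨
    ∣ X ∣                                  ∎
    where open ≡-Reasoning

module SelfCritical (p : ℕ) .{{_ : NonZero p}} (d : ℕ) where

  open import Data.Nat using (_+_; _*_)
  open ResidueRing p
  open CommutativeRing commutativeRing using (_-_; ring)
  open import Algebra.Properties.Ring ring using (-‿involutive)
  open RootsOfUnity commutativeRing d

  ∈negSet⇔ : ∀ {X x} → x ∈ negSet p X ⇔ negₚ p x ∈ X
  ∈negSet⇔ {X} {x} = mk⇔
    (λ x∈-X → lookup⇒[]= _ X (trans (sym (lookup∘tabulate _ x)) ([]=⇒lookup x∈-X)))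
    (λ -x∈X → lookup⇒[]= x _ (trans (lookup∘tabulate _ x) ([]=⇒lookup -x∈X)))

  ∣negSet∣≡∣∣ : ∀ X → ∣ negSet p X ∣ ≡ ∣ X ∣
  ∣negSet∣≡∣∣ X = ∣∣-permute (permutation (negₚ p) (negₚ p) -‿involutive -‿involutive) {X} (λ _ → ∈negSet⇔)

  μ⇔rootOfUnity : ∀ {x} → μ p d x ⇔ RootOfUnity x
  μ⇔rootOfUnity {x} = mk⇔ (trans (sym (powₚ≡^ x d))) (trans (powₚ≡^ x d))

  private
    μ₀⇔rootOfUnity₀ : ∀ {x} → (x ≡ 0ₚ p ⊎ μ p d x) ⇔ RootOfUnity₀ x
    μ₀⇔rootOfUnity₀ = mk⇔ (map₂ (Equivalence.to μ⇔rootOfUnity)) (map₂ (Equivalence.from μ⇔rootOfUnity))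

  sums⇔differences : ∀ {X} →
    (∀ x y → x ∈ X → y ∈ negSet p X → (addₚ p x y ≡ 0ₚ p ⊎ μ p d (addₚ p x y))) ⇔
    DifferencesIn (_∈ X)
  sums⇔differences {X} = mk⇔
    (λ sums {x} {y} x∈X y∈X → Equivalence.to μ₀⇔rootOfUnity₀
      (sums x (negₚ p y) x∈X (Equivalence.from ∈negSet⇔ (subst (_∈ X) (sym (-‿involutive y)) y∈X))))
    (λ differences x y x∈X y∈-X → Equivalence.from μ₀⇔rootOfUnity₀
      (subst (λ z → RootOfUnity₀ (addₚ p x z)) (-‿involutive y)
        (differences x∈X (Equivalence.to ∈negSet⇔ y∈-X))))

  critical⇔ : ∀ {X} → Critical p d X (negSet p X) ⇔
              (1 < ∣ X ∣ × DifferencesIn (_∈ X) × ∣ X ∣ * ∣ X ∣ ≡ d + ∣ X ∣)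
  critical⇔ {X} = mk⇔
    (λ (1<∣X∣ , _ , sums , count) → 1<∣X∣ , Equivalence.to sums⇔differences sums ,
      trans (cong (∣ X ∣ *_) (sym ∣-X∣≡∣X∣)) (trans count (cong (d +_) ∣-X∩-X∣≡∣X∣)))
    (λ (1<∣X∣ , differences , count) → 1<∣X∣ , subst (1 <_) (sym ∣-X∣≡∣X∣) 1<∣X∣ ,
      Equivalence.from sums⇔differences differences ,
      trans (cong (∣ X ∣ *_) ∣-X∣≡∣X∣) (trans count (cong (d +_) (sym ∣-X∩-X∣≡∣X∣))))
    where
    ∣-X∣≡∣X∣ : ∣ negSet p X ∣ ≡ ∣ X ∣
    ∣-X∣≡∣X∣ = ∣negSet∣≡∣∣ X
    ∣-X∩-X∣≡∣X∣ : ∣ negSet p X ∩ negSet p X ∣ ≡ ∣ X ∣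
    ∣-X∩-X∣≡∣X∣ = trans (cong ∣_∣ (∩-idem (negSet p X))) ∣-X∣≡∣X∣

-- y ↦ a - 1/y is a bijection from A^a onto A; to make it a permutation of ℤ/pℤ,
-- 1/y is only taken for y ∈ μ_d, where it is y^(d-1).
module ReciprocalSet (p : ℕ) .{{_ : NonZero p}} (1<p : 1 < p) (k : ℕ) where

  open ResidueRing p
  open CommutativeRing commutativeRing using (_-_; *-comm; semiring)
  open import Algebra.Properties.Semiring.Exp semiring using (_^_)
  open import Data.Nat using (_+_; _*_)
  private
    d : ℕ
    d = suc k

  open RootsOfUnity commutativeRing d

  invertRoots : Fin p → Fin p
  invertRoots y with y ^ d ≟ 1ₚ p
  ... | yes _ = y ^ k
  ... | no  _ = y

  invertRoots-root : ∀ {y} → RootOfUnity y → invertRoots y ≡ y ^ k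
  invertRoots-root {y} y^d≡1 with y ^ d ≟ 1ₚ p
  ... | yes _     = refl
  ... | no  y^d≢1 = contradiction y^d≡1 y^d≢1

  invertRoots-nonRoot : ∀ {y} → ¬ RootOfUnity y → invertRoots y ≡ y
  invertRoots-nonRoot {y} y^d≢1 with y ^ d ≟ 1ₚ p
  ... | yes y^d≡1 = contradiction y^d≡1 y^d≢1
  ... | no  _     = refl

  invertRoots-inverse : ∀ {y z} → RootOfUnity y → mulₚ p y z ≡ 1ₚ p → invertRoots y ≡ z
  invertRoots-inverse {y} y^d≡1 yz≡1 = trans (invertRoots-root y^d≡1) (inverse-unique {y} y^d≡1 yz≡1)

  invertRoots-involutive : ∀ y → invertRoots (invertRoots y) ≡ y
  invertRoots-involutive y with y ^ d ≟ 1ₚ p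
  ... | yes y^d≡1 = invertRoots-inverse (inverse-rootOfUnity {y ^ k} y^k*y≡1 y^d≡1) y^k*y≡1
    where y^k*y≡1 = trans (*-comm (y ^ k) y) y^d≡1
  ... | no y^d≢1  = invertRoots-nonRoot y^d≢1

  invertRoots-0 : invertRoots (0ₚ p) ≡ 0ₚ p
  invertRoots-0 = invertRoots-nonRoot (0ₚ≢1ₚ 1<p ∘ trans (sym (CommutativeRing.zeroˡ commutativeRing _)))

  invertRoots≡0⇒≡0 : ∀ {y} → invertRoots y ≡ 0ₚ p → y ≡ 0ₚ p
  invertRoots≡0⇒≡0 {y} σy≡0 = trans (sym (invertRoots-involutive y)) (trans (cong invertRoots σy≡0) invertRoots-0)

  module _ {A : Subset p} (differences : DifferencesIn (_∈ A)) {a : Fin p} (a∈A : a ∈ A) where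

    reciprocal⇒a-invertRoots∈A : ∀ {y} → Reciprocals (_∈ A) a y → (a - invertRoots y) ∈ A
    reciprocal⇒a-invertRoots∈A (inj₁ refl) = subst (_∈ A) (sym (trans (cong (a -_) invertRoots-0) (x-0≈x a))) a∈A
    reciprocal⇒a-invertRoots∈A {y} (inj₂ (a′ , a′∈A , _ , y[a-a′]≡1)) =
      subst (_∈ A) (sym (trans (cong (a -_) σy≡a-a′) (x-[x-y]≈y a a′))) a′∈A
      where
      a-a′-root : RootOfUnity (a - a′)
      a-a′-root = unit-rootOfUnity₀⇒rootOfUnity {y} y[a-a′]≡1 (differences a∈A a′∈A)
      σy≡a-a′ : invertRoots y ≡ a - a′
      σy≡a-a′ = invertRoots-inverse (inverse-rootOfUnity {y} y[a-a′]≡1 a-a′-root) y[a-a′]≡1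

    a-invertRoots∈A⇒reciprocal : ∀ {y} → (a - invertRoots y) ∈ A → Reciprocals (_∈ A) a y
    a-invertRoots∈A⇒reciprocal {y} a-σy∈A with y ≟ 0ₚ p
    ... | yes y≡0 = inj₁ y≡0
    ... | no  y≢0 = inj₂ (a - invertRoots y , a-σy∈A , a-σy≢a , y[a-[a-σy]]≡1)
      where
      y-root : RootOfUnity y
      y-root = root-from (y ^ d ≟ 1ₚ p)
        where
        root-from : Dec (RootOfUnity y) → RootOfUnity y
        root-from (yes y^d≡1) = y^d≡1
        root-from (no  y^d≢1) =
          [ (λ a-[a-y]≡0 → contradiction (trans (sym (x-[x-y]≈y a y)) a-[a-y]≡0) y≢0)
          , subst RootOfUnity (x-[x-y]≈y a y)
          ]′ (differences a∈A (subst (λ z → (a - z) ∈ A) (invertRoots-nonRoot y^d≢1) a-σy∈A))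
      a-σy≢a : a - invertRoots y ≢ a
      a-σy≢a a-σy≡a = y≢0 (invertRoots≡0⇒≡0 (begin
        invertRoots y           ≡⟨ x-[x-y]≈y a _ ⟨
        a - (a - invertRoots y) ≡⟨ cong (a -_) a-σy≡a ⟩
        a - a                   ≡⟨ CommutativeRing.-‿inverseʳ commutativeRing a ⟩
        0ₚ p                    ∎))
        where open ≡-Reasoning
      y[a-[a-σy]]≡1 : mulₚ p y (a - (a - invertRoots y)) ≡ 1ₚ p
      y[a-[a-σy]]≡1 = trans (cong (mulₚ p y) (trans (x-[x-y]≈y a _) (invertRoots-root y-root))) y-root

    ∣reciprocals∣≡∣∣ : ∀ {B : Subset p} → (∀ y → y ∈ B ⇔ Reciprocals (_∈ A) a y) → ∣ B ∣ ≡ ∣ A ∣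
    ∣reciprocals∣≡∣∣ B⇔Aᵃ = ∣∣-permute π λ y → mk⇔
      (reciprocal⇒a-invertRoots∈A ∘ Equivalence.to (B⇔Aᵃ y))
      (Equivalence.from (B⇔Aᵃ y) ∘ a-invertRoots∈A⇒reciprocal)
      where
      π : Permutation′ p
      π = permutation (λ y → a - invertRoots y) (λ x → invertRoots (a - x))
        (λ x → trans (cong (a -_) (invertRoots-involutive _)) (x-[x-y]≈y a x))
        (λ y → trans (cong invertRoots (x-[x-y]≈y a _)) (invertRoots-involutive y))

  reciprocals-critical : ∀ {A B : Subset p} {a} → a ∈ A → (∀ y → y ∈ B ⇔ Reciprocals (_∈ A) a y) →
                         Critical p d A (negSet p A) → Critical p d B (negSet p B)
  reciprocals-critical {A} {B} a∈A B⇔Aᵃ A-critical =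
    let 1<∣A∣ , differences , ∣A∣²≡d+∣A∣ = Equivalence.to critical⇔ A-critical
        ∣B∣≡∣A∣ = ∣reciprocals∣≡∣∣ differences a∈A B⇔Aᵃ
        to = λ {y} → Equivalence.to (B⇔Aᵃ y)
    in Equivalence.from critical⇔
      ( subst (1 <_) (sym ∣B∣≡∣A∣) 1<∣A∣
      , (λ u∈B y∈B → reciprocals-differences differences a∈A (to u∈B) (to y∈B))
      , subst (λ n → n * n ≡ d + n) (sym ∣B∣≡∣A∣) ∣A∣²≡d+∣A∣ )
    where open SelfCritical p d

lemma7 : (p : ℕ) .{{_ : NonZero p}} → Prime p → (d : ℕ) → d ∣ p ∸ 1 → 1 < d → d < p ∸ 1
    → (A : Subset p) → Critical p d A (negSet p A)
    → (a : Fin p) → a ∈ A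
    → (Aa : Subset p)
    → (∀ x → (x ∈ Aa) ⇔ (x ≡ 0ₚ p ⊎ (∃[ a' ] (a' ∈ A × ¬ (a' ≡ a) × mulₚ p x (subₚ p a a') ≡ 1ₚ p))))
    → Critical p d Aa (negSet p Aa)
lemma7 p _ (suc k) _ 1<d d<p-1 A A-critical a a∈A Aa Aa⇔Aᵃ =
  ReciprocalSet.reciprocals-critical p 1<p k a∈A Aa⇔Aᵃ A-critical
  where
  1<p : 1 < p
  1<p = ℕ.<-trans 1<d (ℕ.<-≤-trans d<p-1 (ℕ.m∸n≤m p 1))
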